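{- Let $U$ be a non-empty set and $\sqsubset$ a binary relation on $U$ such that for every $S\subseteq U$ and every $x\in U$, if $x\,\mathrm{Sup}\,S$ then $x\,\mathrm{Sum}\,S$. Then $U$ has at least two elements.
   Context: Here $x\sqsubset y$ is read "$x$ is a part of $y$". Define, for $x,y\in U$: $x\sqsubseteq y$ iff $x=y$ or $x\sqsubset y$; $x$ overlaps $y$ iff there exists $z\in U$ with $z\sqsubseteq x$ and $z\sqsubseteq y$. For $x\in U$ and $S\subseteq U$: $x\,\mathrm{Sum}\,S$ iff every $s\in S$ satisfies $s\sqsubseteq x$ and every $u\in U$ with $u\sqsubseteq x$ overlaps some element of $S$; $x\,\mathrm{Sup}\,S$ iff every $s\in S$ satisfies $s\sqsubseteq x$, and for every $u\in U$ such that all $s\in S$ satisfy $s\sqsubseteq u$, we have $x\sqsubseteq u$. -}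

module Defs where

open import Level using (Level; _⊔_)
open import Data.Product using (Σ; ∃; _×_)
open import Data.Sum using (_⊎_)
open import Relation.Binary.PropositionalEquality using (_≡_)
open import Relation.Unary using (Pred; _∈_)

module Mereology {a ℓ : Level} {U : Set a} (_⊏_ : U → U → Set ℓ) where

  _⊑_ : U → U → Set (a ⊔ ℓ)
  x ⊑ y = (x ≡ y) ⊎ (x ⊏ y)

  Overlaps : U → U → Set (a ⊔ ℓ)
  Overlaps x y = ∃ λ z → (z ⊑ x) × (z ⊑ y)

  Sum : U → Pred U a → Set (a ⊔ ℓ)
  Sum x S = (∀ s → s ∈ S → s ⊑ x)
          × (∀ u → u ⊑ x → ∃ λ s → (s ∈ S) × Overlaps u s)

  Sup : U → Pred U a → Set (a ⊔ ℓ)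
  Sup x S = (∀ s → s ∈ S → s ⊑ x)
          × (∀ u → (∀ s → s ∈ S → s ⊑ u) → x ⊑ u)

-- In a one-element universe the unique element is a supremum of the empty
-- set (everything lies above it), but nothing is a sum of the empty set,
-- since a sum x has x ⊑ x as a part which must overlap some member of ∅.
module Submission where

open import Defs
open import Level using (Level)
open import Relation.Binary.PropositionalEquality using (_≡_; refl)
open import Relation.Nullary using (¬_)
open import Relation.Unary using (Pred)
open import Data.Empty.Polymorphic using (⊥)
open import Data.Product using (_,_)
open import Data.Sum using (inj₁)

∅ : {a : Level} {U : Set a} → Pred U a
∅ _ = ⊥

module _ {a ℓ : Level} {U : Set a} (_⊏_ : U → U → Set ℓ) where

  open Mereology _⊏_

  ¬Sum-∅ : ∀ x → ¬ Sum x ∅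
  ¬Sum-∅ x (_ , partsOverlap) with partsOverlap x (inj₁ refl)
  ... | _ , () , _

  subsingleton⇒Sup-∅ : (∀ (x y : U) → x ≡ y) → ∀ x → Sup x ∅
  subsingleton⇒Sup-∅ allEqual x = (λ _ ()) , λ u _ → inj₁ (allEqual x u)

mainTheorem5 : {a ℓ : Level} (U : Set a) (_⊏_ : U → U → Set ℓ)
    → U
    → (∀ (S : Pred U a) (x : U) → Mereology.Sup _⊏_ x S → Mereology.Sum _⊏_ x S)
    → ¬ (∀ (x y : U) → x ≡ y)
mainTheorem5 U _⊏_ x sup⇒sum allEqual =
  ¬Sum-∅ _⊏_ x (sup⇒sum ∅ x (subsingleton⇒Sup-∅ _⊏_ allEqual x))
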